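{- Let $Q$ be an IPC formula and let $Z$ be an IPC formula that is a tautology (true under every Boolean valuation). Then $QQZ = (Z \supset Q) \supset Q$ is a theorem of the axiom system $\mathbb{U}_Q$.
   Context: IPC formulas are built from propositional variables using only the connective $\supset$. For an IPC formula $Z$ write $QZ := Z \supset Q$. For a sequence $\theta = (Z_N, \dots, Z_0)$ of IPC formulas, $\mathcal{D}(\theta) := Z_N \supset (Z_{N-1} \supset ( \cdots (Z_0 \supset Q) \cdots ))$, and $(W,\theta)$ denotes $(W, Z_N, \dots, Z_0)$, so $\mathcal{D}(W,\theta) = W \supset \mathcal{D}(\theta)$. In what follows $\theta$ ranges over finite sequences of IPC formulas each of the form $QW$ or $QQW$ for some IPC formula $W$; such $\theta$ is closed if for some $W$ both $QW$ and $QQW$ are terms of $\theta$. A formula $\alpha = Q(X\supset Y)$ has $\alpha_0 = QQX$, $\alpha_1 = QY$; a formula $\beta = QQ(X \supset Y)$ has $\beta_0 = QX$, $\beta_1 = QQY$. The system $\mathbb{U}_Q$ has: axioms all formulas $\mathcal{D}(\theta)$ with $\theta$ closed; Rule A: if a formula $\alpha = Q(X\supset Y)$ is a term of $\theta$, then from $\mathcal{D}(\alpha_0,\theta)$ alone, or from $\mathcal{D}(\alpha_1,\theta)$ alone, infer $\mathcal{D}(\theta)$; Rule B: if a formula $\beta = QQ(X\supset Y)$ is a term of $\theta$, then from $\mathcal{D}(\beta_0,\theta)$ and $\mathcal{D}(\beta_1,\theta)$ together infer $\mathcal{D}(\theta)$. The theorems of $\mathbb{U}_Q$ form the smallest set of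 formulas containing its axioms and closed under Rules A and B. -}

module Defs where

open import Data.Nat using (ℕ)
open import Data.Bool using (Bool; true; false; _∨_; not)
open import Data.List using (List; []; _∷_)
open import Data.List.Membership.Propositional using (_∈_)
open import Data.List.Relation.Unary.All using (All)
open import Data.Product using (∃; _×_)
open import Data.Sum using (_⊎_)
open import Relation.Binary.PropositionalEquality using (_≡_)

data Formula : Set where
  var : ℕ → Formula
  _⊃_ : Formula → Formula → Formula

infixr 5 _⊃_

⟦_⟧ : Formula → (ℕ → Bool) → Bool
⟦ var n ⟧ v = v n
⟦ A ⊃ B ⟧ v = not (⟦ A ⟧ v) ∨ ⟦ B ⟧ v

Tautology : Formula → Set
Tautology Z = ∀ (v : ℕ → Bool) → ⟦ Z ⟧ v ≡ true

module _ (Q : Formula) where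

  QF : Formula → Formula
  QF Z = Z ⊃ Q

  -- D(θ) for θ = (Z_N , … , Z_0) given as the list Z_N ∷ … ∷ Z_0 ∷ []
  D : List Formula → Formula
  D []      = Q
  D (Z ∷ θ) = Z ⊃ D θ

  Shaped : Formula → Set
  Shaped Z = ∃ λ W → (Z ≡ QF W) ⊎ (Z ≡ QF (QF W))

  Closed : List Formula → Set
  Closed θ = ∃ λ W → (QF W ∈ θ) × (QF (QF W) ∈ θ)

  data Theorem : Formula → Set where
    axiom : ∀ θ → All Shaped θ → Closed θ → Theorem (D θ)
    ruleA₀ : ∀ θ X Y → All Shaped θ → QF (X ⊃ Y) ∈ θ →
             Theorem (D (QF (QF X) ∷ θ)) → Theorem (D θ)
    ruleA₁ : ∀ θ X Y → All Shaped θ → QF (X ⊃ Y) ∈ θ →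
             Theorem (D (QF Y ∷ θ)) → Theorem (D θ)
    ruleB  : ∀ θ X Y → All Shaped θ → QF (QF (X ⊃ Y)) ∈ θ →
             Theorem (D (QF X ∷ θ)) → Theorem (D (QF (QF Y) ∷ θ)) →
             Theorem (D θ)

module Submission where

-- Read the terms of θ as signed formulas of a semantic tableau:
-- QW asserts "W is false" and QQW asserts "W is true".  Rule A is then the
-- tableau rule for a false implication (X true and Y false) and Rule B the
-- branching rule for a true implication (X false, or Y true), while an axiom
-- is a branch containing a clash.  The theorem is the completeness of this
-- tableau: if a list of signed formulas recorded in θ has no Boolean model,
-- then D(θ) is a theorem of U_Q.
--
-- Finally QQZ = D(QZ), and the
-- single signed formula "Z is false" has no model when Z is a tautology.

open import Defs
open import Data.Nat using (ℕ; suc; _+_; _<_; s≤s)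
open import Data.Nat.Properties using (+-assoc; +-monoˡ-≤; m≤m+n; m≤n+m; n<1+n; ≤-reflexive)
open import Data.Nat.Induction using (<-wellFounded)
open import Data.Bool using (Bool; true; false)
open import Data.Bool.Properties using (∨-zeroʳ)
open import Data.List using (List; []; _∷_)
open import Data.List.Membership.Propositional using (_∈_)
open import Data.List.Relation.Unary.All as All using (All; []; _∷_)
open import Data.List.Relation.Unary.Any using (here; there)
open import Data.Product using (∃; _×_; _,_)
open import Data.Product.Properties using (≡-dec)
open import Data.Sum using (_⊎_; inj₁; inj₂)
open import Data.Empty using (⊥; ⊥-elim)
open import Induction.WellFounded using (Acc; acc)
open import Relation.Nullary using (¬_; yes; no; does)
open import Relation.Nullary.Decidable using (dec-true; dec-false)
open import Relation.Binary.PropositionalEquality using (_≡_; refl; sym; trans)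
import Data.Bool.Properties as Bool
import Data.Nat.Properties as ℕ
open import Data.List.Membership.DecPropositional (≡-dec Bool._≟_ ℕ._≟_) using (_∈?_)

Valuation : Set
Valuation = ℕ → Bool

Signed : Set
Signed = Bool × Formula

Sat : Valuation → Signed → Set
Sat v (b , W) = ⟦ W ⟧ v ≡ b

Literal : Set
Literal = Bool × ℕ

SatLit : Valuation → Literal → Set
SatLit v (b , n) = v n ≡ b

atom : Literal → Signed
atom (b , n) = b , var n

Clash : List Literal → Set
Clash Λ = ∃ λ n → (true , n) ∈ Λ × (false , n) ∈ Λ

canonical : List Literal → Valuation
canonical Λ n = does ((true , n) ∈? Λ)

clash-or-model : ∀ Λ → Clash Λ ⊎ All (SatLit (canonical Λ)) Λ
clash-or-model Λ = go Λ (λ m → m)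
  where
  go : ∀ Γ → (∀ {l} → l ∈ Γ → l ∈ Λ) → Clash Λ ⊎ All (SatLit (canonical Λ)) Γ
  go [] _ = inj₂ []
  go ((b , n) ∷ Γ) sub with go Γ (λ m → sub (there m))
  ... | inj₁ clash = inj₁ clash
  go ((true , n) ∷ Γ) sub | inj₂ sat = inj₂ (dec-true ((true , n) ∈? Λ) (sub (here refl)) ∷ sat)
  go ((false , n) ∷ Γ) sub | inj₂ sat with (true , n) ∈? Λ
  ... | yes pos = inj₁ (n , pos , sub (here refl))
  ... | no ¬pos = inj₂ (dec-false ((true , n) ∈? Λ) ¬pos ∷ sat)

⊃-true-by-antecedent : ∀ A B v → ⟦ A ⟧ v ≡ false → ⟦ A ⊃ B ⟧ v ≡ true
⊃-true-by-antecedent A B v a rewrite a = refl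

⊃-true-by-consequent : ∀ A B v → ⟦ B ⟧ v ≡ true → ⟦ A ⊃ B ⟧ v ≡ true
⊃-true-by-consequent A B v b rewrite b = ∨-zeroʳ _

⊃-false : ∀ A B v → ⟦ A ⟧ v ≡ true → ⟦ B ⟧ v ≡ false → ⟦ A ⊃ B ⟧ v ≡ false
⊃-false A B v a b rewrite a | b = refl

size : Formula → ℕ
size (var _) = 1
size (A ⊃ B) = suc (size A + size B)

weight : List Signed → ℕ
weight [] = 0
weight ((_ , W) ∷ Δ) = size W + weight Δ

weight-left : ∀ b b′ A B Δ → weight ((b′ , A) ∷ Δ) < weight ((b , A ⊃ B) ∷ Δ)
weight-left _ _ A B Δ = s≤s (+-monoˡ-≤ (weight Δ) (m≤m+n (size A) (size B)))

weight-right : ∀ b b′ A B Δ → weight ((b′ , B) ∷ Δ) < weight ((b , A ⊃ B) ∷ Δ)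
weight-right _ _ A B Δ = s≤s (+-monoˡ-≤ (weight Δ) (m≤n+m (size B) (size A)))

weight-both : ∀ b b₁ b₂ A B Δ →
              weight ((b₁ , A) ∷ (b₂ , B) ∷ Δ) < weight ((b , A ⊃ B) ∷ Δ)
weight-both _ _ _ A B Δ = s≤s (≤-reflexive (sym (+-assoc (size A) (size B) (weight Δ))))

module Tableau (Q : Formula) where

  ⌜_⌝ : Signed → Formula
  ⌜ true , W ⌝ = QF Q (QF Q W)
  ⌜ false , W ⌝ = QF Q W

  ⌜⌝-shaped : ∀ s → Shaped Q ⌜ s ⌝
  ⌜⌝-shaped (true , W) = W , inj₂ refl
  ⌜⌝-shaped (false , W) = W , inj₁ refl

  Recorded : List Formula → List Signed → Set
  Recorded θ Δ = All (λ s → ⌜ s ⌝ ∈ θ) Δ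

  RecordedLits : List Formula → List Literal → Set
  RecordedLits θ Λ = All (λ l → ⌜ atom l ⌝ ∈ θ) Λ

  Unsat : List Literal → List Signed → Set
  Unsat Λ Δ = ∀ v → All (SatLit v) Λ → All (Sat v) Δ → ⊥

  expand-false : ∀ θ A B → All (Shaped Q) θ → ⌜ false , A ⊃ B ⌝ ∈ θ →
                 Theorem Q (D Q (⌜ false , B ⌝ ∷ ⌜ true , A ⌝ ∷ θ)) → Theorem Q (D Q θ)
  expand-false θ A B sh m thm =
    ruleA₀ θ A B sh m (ruleA₁ (⌜ true , A ⌝ ∷ θ) A B (⌜⌝-shaped (true , A) ∷ sh) (there m) thm)

  refute : ∀ θ Λ Δ → All (Shaped Q) θ → RecordedLits θ Λ → Recorded θ Δ →
           Unsat Λ Δ → Acc _<_ (weight Δ) → Theorem Q (D Q θ)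
  refute θ Λ [] sh recΛ [] unsat _ with clash-or-model Λ
  ... | inj₁ (n , pos , neg) = axiom θ sh (var n , All.lookup recΛ neg , All.lookup recΛ pos)
  ... | inj₂ model = ⊥-elim (unsat (canonical Λ) model [])
  refute θ Λ ((b , var n) ∷ Δ) sh recΛ (m ∷ recΔ) unsat (acc rs) =
    refute θ ((b , n) ∷ Λ) Δ sh (m ∷ recΛ) recΔ
      (λ v → λ { (e ∷ eΛ) eΔ → unsat v eΛ (e ∷ eΔ) })
      (rs (n<1+n (weight Δ)))
  refute θ Λ ((true , A ⊃ B) ∷ Δ) sh recΛ (m ∷ recΔ) unsat (acc rs) =
    ruleB θ A B sh m
      (refute (⌜ false , A ⌝ ∷ θ) Λ ((false , A) ∷ Δ)
         (⌜⌝-shaped (false , A) ∷ sh) (All.map there recΛ) (here refl ∷ All.map there recΔ)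
         (λ v → λ { eΛ (a ∷ eΔ) → unsat v eΛ (⊃-true-by-antecedent A B v a ∷ eΔ) })
         (rs (weight-left true false A B Δ)))
      (refute (⌜ true , B ⌝ ∷ θ) Λ ((true , B) ∷ Δ)
         (⌜⌝-shaped (true , B) ∷ sh) (All.map there recΛ) (here refl ∷ All.map there recΔ)
         (λ v → λ { eΛ (b ∷ eΔ) → unsat v eΛ (⊃-true-by-consequent A B v b ∷ eΔ) })
         (rs (weight-right true true A B Δ)))
  refute θ Λ ((false , A ⊃ B) ∷ Δ) sh recΛ (m ∷ recΔ) unsat (acc rs) =
    expand-false θ A B sh m
      (refute (⌜ false , B ⌝ ∷ ⌜ true , A ⌝ ∷ θ) Λ ((true , A) ∷ (false , B) ∷ Δ)
         (⌜⌝-shaped (false , B) ∷ ⌜⌝-shaped (true , A) ∷ sh)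
         (All.map (λ x → there (there x)) recΛ)
         (there (here refl) ∷ here refl ∷ All.map (λ x → there (there x)) recΔ)
         (λ v → λ { eΛ (a ∷ b ∷ eΔ) → unsat v eΛ (⊃-false A B v a b ∷ eΔ) })
         (rs (weight-both false true false A B Δ)))

  completeness : ∀ θ Δ → All (Shaped Q) θ → Recorded θ Δ →
                 (∀ v → ¬ All (Sat v) Δ) → Theorem Q (D Q θ)
  completeness θ Δ sh recΔ unsat =
    refute θ [] Δ sh [] recΔ (λ v _ → unsat v) (<-wellFounded (weight Δ))

mainTheorem8 : (Q Z : Formula) → Tautology Z → Theorem Q (QF Q (QF Q Z))
mainTheorem8 Q Z taut =
  completeness (QF Q Z ∷ []) ((false , Z) ∷ []) (⌜⌝-shaped (false , Z) ∷ [])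
    (here refl ∷ []) Z-never-false
  where
  open Tableau Q
  Z-never-false : ∀ v → ¬ All (Sat v) ((false , Z) ∷ [])
  Z-never-false v (z ∷ []) with () ← trans (sym z) (taut v)
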